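{- Let $a<b$ be relatively prime positive integers and $\mathcal{U}=\mathcal{U}(a,b)$. Then $a(b+1)\in\mathcal{U}$ and $(a+1)b\in\mathcal{U}$.
   Context: For positive integers $a<b$, the Ulam sequence $\mathcal{U}(a,b)$ has first terms $a,b$, and each subsequent term is the smallest integer larger than all previous terms that can be written as the sum of two distinct earlier terms in exactly one way (unordered pairs). The sequence is identified with its set of terms. -}

module Defs where

open import Data.Nat using (ℕ; zero; suc; _+_; _<_; _≤_)
open import Data.Product using (Σ; _×_; ∃-syntax)
open import Relation.Binary.PropositionalEquality using (_≡_)
open import Relation.Nullary using (¬_)

-- Since u is strictly increasing, index
-- pairs i < j correspond bijectively to unordered pairs of distinct terms.
UniqueRep : (ℕ → ℕ) → ℕ → ℕ → Set
UniqueRep u k m =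
  Σ ℕ λ i → Σ ℕ λ j →
    (i < j × j ≤ k × u i + u j ≡ m) ×
    (∀ i′ j′ → i′ < j′ → j′ ≤ k → u i′ + u j′ ≡ m → (i′ ≡ i × j′ ≡ j))

IsUlam : ℕ → ℕ → (ℕ → ℕ) → Set
IsUlam a b u =
  u 0 ≡ a × u 1 ≡ b ×
  (∀ k → u (suc k) < u (suc (suc k))) ×
  (∀ k → UniqueRep u (suc k) (u (suc (suc k)))) ×
  (∀ k m → u (suc k) < m → m < u (suc (suc k)) → ¬ UniqueRep u (suc k) m)

_∈U_ : ℕ → (ℕ → ℕ) → Set
n ∈U u = ∃[ k ] u k ≡ n

-- Every term of U(a,b) other than a and b is x a + y b with x, y ≥ 1.  Fix one
-- generator p and let q be the other.  Two distinct terms that both differ from q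
-- sum to p + (x p + y q) with x, y ≥ 1, and by coprimality x p + y q = k q forces
-- p < k.  So for k ≤ p every representation of p + k q as a sum of two distinct
-- terms uses q; such a representation is unique, and a uniquely represented
-- number above b is a term.  Induction on k, starting from p itself, therefore
-- puts p, p + q, …, p + p q in U, and the cases p = a and p = b give
-- a + ab = a(b+1) and b + ab = (a+1)b.  When a = 1, the terms b, b + 1, …, 2b
-- arise in the same way, because 1 is the only term below b.
module Submission where

open import Defs
open import Data.Nat
open import Data.Nat.Properties
open import Data.Nat.Divisibility using (_∣_; ∣-refl; ∣m+n∣m⇒∣n; n∣m*n; ∣⇒≤)
open import Data.Nat.Coprimality using (Coprime; coprime-divisor)
import Data.Nat.Coprimality as Coprimality
open import Data.Nat.Induction using (<-rec)
open import Algebra.Properties.CommutativeSemigroup +-commutativeSemigroup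
  using (interchange; x∙yz≈y∙xz)
open import Data.Product using (Σ; ∃₂; _×_; _,_; proj₁; proj₂)
open import Data.Sum using (_⊎_; inj₁; inj₂)
open import Data.Empty using (⊥-elim)
open import Relation.Nullary using (¬_; yes; no)
open import Relation.Binary.Definitions using (tri<; tri≈; tri>)
open import Relation.Binary.PropositionalEquality
open import Function using (_∘_)

coprime-combination-bound : ∀ {p q x y z} → Coprime p q → .{{_ : NonZero q}} →
  suc x * p + y * q ≡ z * q → p + y ≤ z
coprime-combination-bound {p} {q} {x} {y} {z} cop eq = *-cancelʳ-≤ (p + y) z q (begin
  (p + y) * q          ≡⟨ *-distribʳ-+ q p y ⟩
  p * q + y * q        ≤⟨ +-monoˡ-≤ (y * q) p*q≤ ⟩
  suc x * p + y * q    ≡⟨ eq ⟩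
  z * q                ∎)
  where
  open ≤-Reasoning
  q∣[1+x] : q ∣ suc x
  q∣[1+x] = coprime-divisor (Coprimality.sym cop) (subst (q ∣_) (*-comm (suc x) p)
    (∣m+n∣m⇒∣n (subst (q ∣_) (trans (sym eq) (+-comm (suc x * p) (y * q))) (n∣m*n z)) (n∣m*n y)))
  p*q≤ : p * q ≤ suc x * p
  p*q≤ = subst (p * q ≤_) (*-comm p (suc x)) (*-monoʳ-≤ p (∣⇒≤ q∣[1+x]))

data Shape (p q : ℕ) : ℕ → Set where
  first  : Shape p q p
  second : Shape p q q
  mixed  : ∀ x y → Shape p q (suc x * p + suc y * q)

mixed′ : ∀ {p q t} x y → t ≡ suc x * p + suc y * q → Shape p q t
mixed′ x y refl = mixed x y

Shape-swap : ∀ {p q t} → Shape p q t → Shape q p t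
Shape-swap first = second
Shape-swap second = first
Shape-swap {p} {q} (mixed x y) = mixed′ y x (+-comm (suc x * p) (suc y * q))

combination-+ : ∀ p q x₁ y₁ x₂ y₂ →
  (x₁ * p + y₁ * q) + (x₂ * p + y₂ * q) ≡ (x₁ + x₂) * p + (y₁ + y₂) * q
combination-+ p q x₁ y₁ x₂ y₂ = trans (interchange (x₁ * p) (y₁ * q) (x₂ * p) (y₂ * q))
  (sym (cong₂ _+_ (*-distribʳ-+ p x₁ x₂) (*-distribʳ-+ q y₁ y₂)))

Shape-+ : ∀ {p q s t} → Shape p q s → Shape p q t → s ≢ t → Shape p q (s + t)
Shape-+ first first s≢t = ⊥-elim (s≢t refl)
Shape-+ second second s≢t = ⊥-elim (s≢t refl)
Shape-+ {p} {q} first second _ = mixed′ 0 0 (sym (cong₂ _+_ (+-identityʳ p) (+-identityʳ q)))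
Shape-+ {p} {q} first (mixed x y) _ = mixed′ (suc x) y (sym (+-assoc p (suc x * p) (suc y * q)))
Shape-+ {p} {q} second (mixed x y) _ = mixed′ x (suc y) (x∙yz≈y∙xz q (suc x * p) (suc y * q))
Shape-+ {p} {q} {s} {t} f@second g@first s≢t =
  subst (Shape p q) (+-comm t s) (Shape-+ g f (≢-sym s≢t))
Shape-+ {p} {q} {s} {t} m@(mixed _ _) g@first s≢t =
  subst (Shape p q) (+-comm t s) (Shape-+ g m (≢-sym s≢t))
Shape-+ {p} {q} {s} {t} m@(mixed _ _) g@second s≢t =
  subst (Shape p q) (+-comm t s) (Shape-+ g m (≢-sym s≢t))
Shape-+ {p} {q} (mixed x₁ y₁) (mixed x₂ y₂) _ =
  mixed′ (x₁ + suc x₂) (y₁ + suc y₂) (combination-+ p q (suc x₁) (suc y₁) (suc x₂) (suc y₂))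

Shape-+-avoiding-second : ∀ {p q s t} → Shape p q s → Shape p q t → s ≢ t → s ≢ q → t ≢ q →
  ∃₂ λ x y → s + t ≡ p + (suc x * p + suc y * q)
Shape-+-avoiding-second first first s≢t _ _ = ⊥-elim (s≢t refl)
Shape-+-avoiding-second second _ _ s≢q _ = ⊥-elim (s≢q refl)
Shape-+-avoiding-second _ second _ _ t≢q = ⊥-elim (t≢q refl)
Shape-+-avoiding-second first (mixed x y) _ _ _ = x , y , refl
Shape-+-avoiding-second {p} (mixed x y) first _ _ _ = x , y , +-comm (suc x * p + _) p
Shape-+-avoiding-second {p} {q} (mixed x₁ y₁) (mixed x₂ y₂) _ _ _ = x₁ + x₂ , y₁ + suc y₂ , (begin
  (suc x₁ * p + suc y₁ * q) + (suc x₂ * p + suc y₂ * q)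
    ≡⟨ combination-+ p q (suc x₁) (suc y₁) (suc x₂) (suc y₂) ⟩
  suc (x₁ + suc x₂) * p + suc (y₁ + suc y₂) * q
    ≡⟨ cong (λ c → suc c * p + suc (y₁ + suc y₂) * q) (+-suc x₁ x₂) ⟩
  (p + suc (x₁ + x₂) * p) + suc (y₁ + suc y₂) * q
    ≡⟨ +-assoc p _ _ ⟩
  p + (suc (x₁ + x₂) * p + suc (y₁ + suc y₂) * q) ∎)
  where open ≡-Reasoning

SumsThrough : (ℕ → ℕ) → ℕ → ℕ → Set
SumsThrough u v n = ∀ i j → i < j → u i + u j ≡ n → u i ≡ v ⊎ u j ≡ v

other-summand : ∀ {s t v w} → s ≡ v → s + t ≡ v + w → t ≡ w
other-summand {s} refl = +-cancelˡ-≡ s _ _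

sumsThrough-swap : ∀ {u v w} → SumsThrough u v (v + w) → SumsThrough u w (w + v)
sumsThrough-swap {u} {v} {w} through i j i<j e with through i j i<j (trans e (+-comm w v))
... | inj₁ ui≡v = inj₂ (other-summand ui≡v (trans e (+-comm w v)))
... | inj₂ uj≡v = inj₁ (other-summand uj≡v (trans (+-comm (u j) (u i)) (trans e (+-comm w v))))

module UlamSequence {a b : ℕ} (0<a : 0 < a) (a<b : a < b) (u : ℕ → ℕ) (U : IsUlam a b u) where

  u0≡a : u 0 ≡ a
  u0≡a = proj₁ U

  u1≡b : u 1 ≡ b
  u1≡b = proj₁ (proj₂ U)

  u-<-suc : ∀ n → u n < u (suc n)
  u-<-suc zero = subst₂ _<_ (sym u0≡a) (sym u1≡b) a<b
  u-<-suc (suc n) = proj₁ (proj₂ (proj₂ U)) n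

  u-uniqueRep : ∀ k → UniqueRep u (suc k) (u (suc (suc k)))
  u-uniqueRep = proj₁ (proj₂ (proj₂ (proj₂ U)))

  between-¬uniqueRep : ∀ k n → u (suc k) < n → n < u (suc (suc k)) → ¬ UniqueRep u (suc k) n
  between-¬uniqueRep = proj₂ (proj₂ (proj₂ (proj₂ U)))

  u-mono-< : ∀ {i j} → i < j → u i < u j
  u-mono-< {i} {suc j} i<1+j with m≤n⇒m<n∨m≡n (s≤s⁻¹ i<1+j)
  ... | inj₁ i<j = <-trans (u-mono-< i<j) (u-<-suc j)
  ... | inj₂ refl = u-<-suc i

  u-mono-≤ : ∀ {i j} → i ≤ j → u i ≤ u j
  u-mono-≤ i≤j with m≤n⇒m<n∨m≡n i≤j
  ... | inj₁ i<j = <⇒≤ (u-mono-< i<j)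
  ... | inj₂ refl = ≤-refl

  u-cancel-< : ∀ {i j} → u i < u j → i < j
  u-cancel-< {i} {j} ui<uj = ≰⇒> (λ j≤i → <⇒≱ ui<uj (u-mono-≤ j≤i))

  u-injective : ∀ {i j} → u i ≡ u j → i ≡ j
  u-injective {i} {j} ui≡uj with <-cmp i j
  ... | tri< i<j _ _ = ⊥-elim (<⇒≢ (u-mono-< i<j) ui≡uj)
  ... | tri≈ _ i≡j _ = i≡j
  ... | tri> _ _ j<i = ⊥-elim (<⇒≢ (u-mono-< j<i) (sym ui≡uj))

  u-positive : ∀ i → 0 < u i
  u-positive i = <-≤-trans 0<a (subst (_≤ u i) u0≡a (u-mono-≤ z≤n))

  n≤u[n] : ∀ n → n ≤ u n
  n≤u[n] zero = z≤n
  n≤u[n] (suc n) = <-≤-trans (s≤s (n≤u[n] n)) (u-<-suc n)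

  bracket : ∀ {n} t → b < n → n ≤ u (suc t) → Σ ℕ λ k → u (suc k) < n × n ≤ u (suc (suc k))
  bracket zero b<n n≤u1 = ⊥-elim (<⇒≱ b<n (subst (_ ≤_) u1≡b n≤u1))
  bracket {n} (suc t) b<n n≤u[2+t] with n ≤? u (suc t)
  ... | yes n≤u[1+t] = bracket t b<n n≤u[1+t]
  ... | no n≰u[1+t] = t , ≰⇒> n≰u[1+t] , n≤u[2+t]

  uniqueRep⇒∈U : ∀ {n} → b < n → (∀ k → n ≤ u (suc (suc k)) → UniqueRep u (suc k) n) → n ∈U u
  uniqueRep⇒∈U {n} b<n rep with bracket n b<n (<⇒≤ (<-≤-trans (n<1+n n) (n≤u[n] (suc n))))
  ... | k , above , below with m≤n⇒m<n∨m≡n below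
  ...   | inj₁ n<u[2+k] = ⊥-elim (between-¬uniqueRep k n above n<u[2+k] (rep k below))
  ...   | inj₂ n≡u[2+k] = suc (suc k) , sym n≡u[2+k]

  uniqueRep-of-sumsThrough : ∀ {iv iw K} → u iv < u iw → iw ≤ K →
    SumsThrough u (u iv) (u iv + u iw) → UniqueRep u K (u iv + u iw)
  uniqueRep-of-sumsThrough {iv} {iw} {K} uv<uw iw≤K through =
    iv , iw , (u-cancel-< uv<uw , iw≤K , refl) , unique
    where
    unique : ∀ i j → i < j → j ≤ K → u i + u j ≡ u iv + u iw → i ≡ iv × j ≡ iw
    unique i j i<j _ e with through i j i<j e
    ... | inj₁ ui≡uv = u-injective ui≡uv , u-injective (other-summand ui≡uv e)
    ... | inj₂ uj≡uv = ⊥-elim (<-asym uv<uw (subst₂ _<_ ui≡uw uj≡uv (u-mono-< i<j)))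
      where
      ui≡uw : u i ≡ u iw
      ui≡uw = other-summand uj≡uv (trans (+-comm (u j) (u i)) e)

  index-≤ : ∀ {i n k} → u i < n → n ≤ u (suc (suc k)) → i ≤ suc k
  index-≤ ui<n n≤u[2+k] = s≤s⁻¹ (u-cancel-< (<-≤-trans ui<n n≤u[2+k]))

  ordered-sumsThrough⇒∈U : ∀ {iv iw} → b < u iv + u iw → u iv < u iw →
    SumsThrough u (u iv) (u iv + u iw) → (u iv + u iw) ∈U u
  ordered-sumsThrough⇒∈U {iv} {iw} b<n uv<uw through = uniqueRep⇒∈U b<n λ k below →
    uniqueRep-of-sumsThrough uv<uw (index-≤ (m<n+m (u iw) (u-positive iv)) below) through

  sumsThrough⇒∈U : ∀ {n v w} → b < n → v ∈U u → w ∈U u → v + w ≡ n → v ≢ w →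
    SumsThrough u v n → n ∈U u
  sumsThrough⇒∈U b<n (iv , refl) (iw , refl) refl v≢w through with <-cmp (u iv) (u iw)
  ... | tri< uv<uw _ _ = ordered-sumsThrough⇒∈U b<n uv<uw through
  ... | tri≈ _ uv≡uw _ = ⊥-elim (v≢w uv≡uw)
  ... | tri> _ _ uw<uv = subst (_∈U u) (+-comm (u iw) (u iv))
    (ordered-sumsThrough⇒∈U (subst (b <_) (+-comm (u iv) (u iw)) b<n) uw<uv
      (sumsThrough-swap through))

  shape : ∀ i → Shape a b (u i)
  shape = <-rec (λ i → Shape a b (u i)) step
    where
    step : ∀ n → (∀ {m} → m < n → Shape a b (u m)) → Shape a b (u n)
    step zero _ = subst (Shape a b) (sym u0≡a) first
    step (suc zero) _ = subst (Shape a b) (sym u1≡b) second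
    step (suc (suc k)) rec with u-uniqueRep k
    ... | i , j , (i<j , j≤1+k , e) , _ = subst (Shape a b) e
      (Shape-+ (rec (<-trans i<j (s≤s j≤1+k))) (rec (s≤s j≤1+k)) (<⇒≢ (u-mono-< i<j)))

  b+k∈U : a ≡ 1 → ∀ k → k ≤ b → (b + k) ∈U u
  b+k∈U a≡1 zero _ = 1 , trans u1≡b (sym (+-identityʳ b))
  b+k∈U a≡1 (suc k) 1+k≤b =
    sumsThrough⇒∈U (m<m+n b z<s) (0 , u0≡a) (b+k∈U a≡1 k (<⇒≤ 1+k≤b)) a+[b+k] a≢b+k through-a
    where
    a+[b+k] : a + (b + k) ≡ b + suc k
    a+[b+k] = trans (cong (_+ (b + k)) a≡1) (sym (+-suc b k))
    a≢b+k : a ≢ b + k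
    a≢b+k = <⇒≢ (<-≤-trans a<b (m≤m+n b k))
    through-a : SumsThrough u a (b + suc k)
    through-a zero _ _ _ = inj₁ u0≡a
    through-a (suc i) j 1+i<j e =
      ⊥-elim (<⇒≢ (≤-<-trans (+-monoʳ-≤ b 1+k≤b) (+-mono-≤-< b≤ b<)) (sym e))
      where
      b≤ : b ≤ u (suc i)
      b≤ = subst (_≤ u (suc i)) u1≡b (u-mono-≤ (s≤s z≤n))
      b< : b < u j
      b< = ≤-<-trans b≤ (u-mono-< 1+i<j)

module Generators {u : ℕ → ℕ} {p q : ℕ} (0<p : 0 < p) (1<q : 1 < q) (cop : Coprime p q)
  (p∈U : p ∈U u) (q∈U : q ∈U u) (shape : ∀ i → Shape p q (u i))
  (u-injective : ∀ {i j} → u i ≡ u j → i ≡ j)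
  (sumsThrough⇒∈U : ∀ {n v w} → p < n → q < n → v ∈U u → w ∈U u → v + w ≡ n → v ≢ w →
                      SumsThrough u v n → n ∈U u)
  where

  0<q : 0 < q
  0<q = <-trans z<s 1<q

  instance
    q-nonZero : NonZero q
    q-nonZero = >-nonZero 0<q

  q≢p+k*q : ∀ k → q ≢ p + k * q
  q≢p+k*q k q≡p+k*q = <⇒≢ 1<q (sym (cop (q∣p , ∣-refl)))
    where
    q∣p : q ∣ p
    q∣p = ∣m+n∣m⇒∣n (subst (q ∣_) (trans q≡p+k*q (+-comm p (k * q))) ∣-refl) (n∣m*n k)

  sumsThrough-q : ∀ k → suc k ≤ p → SumsThrough u q (p + suc k * q)
  sumsThrough-q k 1+k≤p i j i<j e with u i ≟ q | u j ≟ q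
  ... | yes ui≡q | _ = inj₁ ui≡q
  ... | no _ | yes uj≡q = inj₂ uj≡q
  ... | no ui≢q | no uj≢q
    with Shape-+-avoiding-second (shape i) (shape j) (<⇒≢ i<j ∘ u-injective) ui≢q uj≢q
  ...   | x , y , e′ = ⊥-elim (m+1+n≰m p (≤-trans p+1+y≤1+k 1+k≤p))
    where
    p+1+y≤1+k : p + suc y ≤ suc k
    p+1+y≤1+k = coprime-combination-bound {x = x} cop (+-cancelˡ-≡ p _ _ (trans (sym e′) e))

  p+k*q∈U : ∀ k → k ≤ p → (p + k * q) ∈U u
  p+k*q∈U zero _ = subst (_∈U u) (sym (+-identityʳ p)) p∈U
  p+k*q∈U (suc k) 1+k≤p =
    sumsThrough⇒∈U p<n q<n q∈U (p+k*q∈U k (<⇒≤ 1+k≤p)) (x∙yz≈y∙xz q p (k * q)) (q≢p+k*q k)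
      (sumsThrough-q k 1+k≤p)
    where
    p<n : p < p + suc k * q
    p<n = m<m+n p (<-≤-trans 0<q (m≤m+n q (k * q)))
    q<n : q < p + suc k * q
    q<n = <-≤-trans (m<n+m q 0<p) (+-monoʳ-≤ p (m≤m+n q (k * q)))

lemma5p8 : (a b : ℕ) → 0 < a → a < b → Coprime a b →
    (u : ℕ → ℕ) → IsUlam a b u →
    (a * (b + 1)) ∈U u × ((a + 1) * b) ∈U u
lemma5p8 a b 0<a a<b cop u U with m≤n⇒m<n∨m≡n 0<a
... | inj₂ refl =
  subst (_∈U u) (sym (*-identityˡ (b + 1))) (b+k∈U refl 1 (<⇒≤ a<b)) ,
  subst (_∈U u) (cong (b +_) (sym (+-identityʳ b))) (b+k∈U refl b ≤-refl)
  where open UlamSequence 0<a a<b u U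
... | inj₁ 1<a =
  subst (_∈U u) (sym (trans (cong (a *_) (+-comm b 1)) (*-suc a b))) (AB.p+k*q∈U a ≤-refl) ,
  subst (_∈U u) (sym (trans (cong (_* b) (+-comm a 1)) (cong (b +_) (*-comm a b))))
    (BA.p+k*q∈U b ≤-refl)
  where
  open UlamSequence 0<a a<b u U
  1<b : 1 < b
  1<b = <-trans 1<a a<b
  module AB = Generators 0<a 1<b cop (0 , u0≡a) (1 , u1≡b) shape u-injective
    (λ _ b<n → sumsThrough⇒∈U b<n)
  module BA = Generators (<-trans 0<a a<b) 1<a (Coprimality.sym cop) (1 , u1≡b) (0 , u0≡a)
    (λ i → Shape-swap (shape i)) u-injective (λ b<n _ → sumsThrough⇒∈U b<n)
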